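{- Let $\mathbf{a}=(a_1,\ldots,a_n)$ be a weak composition of length $n$. Then the lock polynomial $\mathfrak{L}_{\mathbf{a}}$ is quasisymmetric in $x_1,\ldots,x_n$ if and only if $\mathbf{a}$ has no zero parts or the parts of $\mathbf{a}$ are weakly increasing.
   Context: A weak composition is a finite sequence $\mathbf{a}=(a_1,\ldots,a_n)$ of nonnegative integers. A diagram is a finite set of cells $(c,r)$ with $c,r$ positive integers; $c$ is the column and $r$ the row (rows numbered from the bottom). A labeled diagram assigns a positive integer label to each cell; its weight $\mathrm{wt}(T)$ is the weak composition whose $r$-th part is the number of cells in row $r$, and $x^{\mathrm{wt}(T)}=\prod_r x_r^{\mathrm{wt}(T)_r}$. Let $M=\max_i a_i$. A lock Kohnert tableau of content $\mathbf{a}$ is a labeled diagram with labels $1^{a_1},\ldots,n^{a_n}$ (one per cell) such that: (1) for each $i$ there is exactly one cell labeled $i$ in each of the columns $M-a_i+1,\ldots,M$; (2) every label in row $r$ is at least $r$; (3) the cells labeled $i$ weakly descend (in row index) from left to right; (4) labels strictly decrease going down each column. Let $\mathrm{LKT}(\mathbf{a})$ be the set of these; the lock polynomial is $\mathfrak{L}_{\mathbf{a}}=\sum_{T\in\mathrm{LKT}(\mathbf{a})}x^{\mathrm{wt}(T)}$. A polynomial in $x_1,\ldots,x_n$ is quasisymmetric if for all positive integers $b_1,\ldots,b_k$ and all $i_1<\cdots<i_k$, $j_1<\cdots<j_k$, the coefficients of $x_{i_1}^{b_1}\cdots x_{i_k}^{b_k}$ and $x_{j_1}^{b_1}\cdots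 x_{j_k}^{b_k}$ agree. -}

module Defs where

open import Data.Nat using (ℕ; zero; suc; _+_; _∸_; _≤_; _<_; _⊔_)
open import Data.Nat.Properties using (_≟_; _≤?_; _<?_)
open import Data.Fin using (Fin; toℕ) renaming (_≟_ to _≟ᶠ_)
open import Data.Fin.Properties using (all?)
open import Data.Maybe using (Maybe; just; nothing; is-just)
open import Data.Maybe.Properties using (≡-dec)
open import Data.Bool using (Bool; true; false; if_then_else_)
open import Data.List using (List; []; _∷_; map; concatMap; filter; length; allFin)
open import Data.Nat.ListAction using (sum)
open import Data.Vec using (Vec; lookup)
import Data.Vec as Vec
open import Data.Vec.Functional using (Vector)
import Data.Vec.Functional as VF
open import Data.Product using (_×_)
open import Relation.Nullary using (Dec; does)
open import Relation.Nullary.Decidable using (_×-dec_; _→-dec_)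
open import Relation.Binary.PropositionalEquality using (_≡_)

-- A weak composition of length n is a vector a = (a_1,...,a_n) of naturals;
-- part a_i is  lookup a i  (Fin index i represents the integer i+1).
maxPart : ∀ {n} → Vec ℕ n → ℕ
maxPart = Vec.foldr _ _⊔_ 0

-- Every lock Kohnert tableau of content a lives in the box of columns
-- 1..M and rows 1..n: columns by condition (1), rows by condition (2)
-- (row ≤ label ≤ n).  A labeled diagram in this box is a function
-- assigning to each cell (column c, row r) either no cell (nothing) or a
-- cell carrying label (just i).  Fin indices represent c+1, r+1, i+1.

LDiagram : ℕ → ℕ → Set
LDiagram M n = Fin M → Fin n → Maybe (Fin n)

occ : ∀ {M n} → LDiagram M n → Fin M → Fin n → ℕ
occ {M} {n} T c i = length (filter (λ r → ≡-dec _≟ᶠ_ (T c r) (just i)) (allFin n))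

-- (1) label i occurs exactly once in each of the columns M-a_i+1,...,M
--     (and nowhere else)
Cond1 : ∀ {n} (a : Vec ℕ n) → LDiagram (maxPart a) n → Set
Cond1 a T = ∀ i c → occ T c i ≡ (if does (maxPart a ∸ lookup a i ≤? toℕ c) then 1 else 0)

Cond2 : ∀ {M n} → LDiagram M n → Set
Cond2 T = ∀ c r i → T c r ≡ just i → toℕ r ≤ toℕ i

Cond3 : ∀ {M n} → LDiagram M n → Set
Cond3 T = ∀ i c c′ r r′ → toℕ c < toℕ c′ → T c r ≡ just i → T c′ r′ ≡ just i →
          toℕ r′ ≤ toℕ r

Cond4 : ∀ {M n} → LDiagram M n → Set
Cond4 T = ∀ c r r′ i j → toℕ r < toℕ r′ → T c r ≡ just i → T c r′ ≡ just j →
          toℕ i < toℕ j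

IsLKT : ∀ {n} (a : Vec ℕ n) → LDiagram (maxPart a) n → Set
IsLKT a T = Cond1 a T × Cond2 T × Cond3 T × Cond4 T

wt : ∀ {M n} → LDiagram M n → Fin n → ℕ
wt {M} T r = sum (map (λ c → if is-just (T c r) then 1 else 0) (allFin M))

HasWeight : ∀ {M n} → LDiagram M n → (Fin n → ℕ) → Set
HasWeight T b = ∀ r → wt T r ≡ b r

private
  dec∀ : ∀ {k} {P : Fin k → Set} → (∀ x → Dec (P x)) → Dec (∀ x → P x)
  dec∀ = all?

  eqL : ∀ {M n} (T : LDiagram M n) c r i → Dec (T c r ≡ just i)
  eqL T c r i = ≡-dec _≟ᶠ_ (T c r) (just i)

isLKT? : ∀ {n} (a : Vec ℕ n) (T : LDiagram (maxPart a) n) → Dec (IsLKT a T)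
isLKT? a T =
  dec∀ (λ i → dec∀ (λ c → occ T c i ≟ _)) ×-dec
  (dec∀ (λ c → dec∀ (λ r → dec∀ (λ i → eqL T c r i →-dec (toℕ r ≤? toℕ i)))) ×-dec
  (dec∀ (λ i → dec∀ (λ c → dec∀ (λ c′ → dec∀ (λ r → dec∀ (λ r′ →
     (toℕ c <? toℕ c′) →-dec (eqL T c r i →-dec (eqL T c′ r′ i →-dec (toℕ r′ ≤? toℕ r)))))))) ×-dec
   dec∀ (λ c → dec∀ (λ r → dec∀ (λ r′ → dec∀ (λ i → dec∀ (λ j →
     (toℕ r <? toℕ r′) →-dec (eqL T c r i →-dec (eqL T c r′ j →-dec (toℕ i <? toℕ j))))))))))

hasWeight? : ∀ {M n} (T : LDiagram M n) (b : Fin n → ℕ) → Dec (HasWeight T b)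
hasWeight? T b = dec∀ (λ r → wt T r ≟ b r)

allFuns : ∀ {A : Set} (k : ℕ) → List A → List (Fin k → A)
allFuns zero    xs = (λ ()) ∷ []
allFuns (suc k) xs = concatMap (λ x → map (λ f → x VF.∷ f) (allFuns k xs)) xs

allDiagrams : (M n : ℕ) → List (LDiagram M n)
allDiagrams M n = allFuns M (allFuns n (nothing ∷ map just (allFin n)))

-- The lock polynomial, represented by its coefficient function:
-- lockCoeff a b = coefficient of x^b = #{ T ∈ LKT(a) : wt(T) = b }.

lockCoeff : ∀ {n} (a : Vec ℕ n) → (Fin n → ℕ) → ℕ
lockCoeff {n} a b =
  length (filter (λ T → isLKT? a T ×-dec hasWeight? T b) (allDiagrams (maxPart a) n))

-- exponent vector of x_{i_1}^{b_1} ... x_{i_k}^{b_k}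
monomial : ∀ {k n} → (Fin k → Fin n) → (Fin k → ℕ) → Fin n → ℕ
monomial {k} i b r = sum (map (λ t → if does (i t ≟ᶠ r) then b t else 0) (allFin k))

StrictlyIncreasing : ∀ {k n} → (Fin k → Fin n) → Set
StrictlyIncreasing i = ∀ s t → toℕ s < toℕ t → toℕ (i s) < toℕ (i t)

QuasiSymmetric : (n : ℕ) → ((Fin n → ℕ) → ℕ) → Set
QuasiSymmetric n f =
  ∀ (k : ℕ) (b : Fin k → ℕ) (i j : Fin k → Fin n) →
  (∀ t → 0 < b t) → StrictlyIncreasing i → StrictlyIncreasing j →
  f (monomial i b) ≡ f (monomial j b)

NoZeroParts : ∀ {n} → Vec ℕ n → Set
NoZeroParts a = ∀ i → 0 < lookup a i

WeaklyIncreasing : ∀ {n} → Vec ℕ n → Set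
WeaklyIncreasing a = ∀ i j → toℕ i ≤ toℕ j → lookup a i ≤ lookup a j

module Submission where

-- The central
-- tool is the row swap σ q, exchanging rows q and q+1: it permutes the enumeration, so
-- counts are invariant under it, and it preserves lock tableaux when one of the two rows
-- is empty and no label q sits in row q.  (Rows, labels, parts and variables are numbered
-- from 0, as the Fin indices of Defs.)  After developing finite sums and counting, the
-- swap and its invariances, and these facts about σ q, the file proves:
--
-- (⇐) Under either condition a has the lifting property (row q+1 empty forces the labels
--     of row q above q), so σ q identifies the lock tableaux of weights b and b ∘ swap q
--     when b_q = 0.  Moving zero exponents to the end brings every monomial with
--     exponents b at increasing positions to the one with b in the first positions,
--     which gives quasisymmetry.
-- (⇒) Otherwise a has a zero part and a descent, and an explicit separating tableau T
--     exists (row q+1 empty, label q in row q).  σ q injects the tableaux of weight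
--     wt(T) ∘ swap q into those of weight wt(T) without hitting T, so these coefficients
--     differ, whereas quasisymmetry forces them to agree.

open import Defs
open import Data.Nat using (ℕ)
open import Data.Vec using (Vec)
open import Data.Sum using (_⊎_)
open import Function.Bundles using (_⇔_)

open import Data.Bool using (true; false; if_then_else_)
open import Data.Empty using (⊥; ⊥-elim)
open import Data.Fin using (Fin; toℕ; fromℕ; fromℕ<; punchOut) renaming (zero to fz; suc to fs; _≟_ to _≟ᶠ_)
open import Data.Fin.Properties using (toℕ-injective; toℕ-fromℕ<; toℕ-fromℕ; toℕ<n; injective⇒≤; punchIn-punchOut)
open import Data.List using (List; []; _∷_; map; concatMap; filter; length; allFin; _++_)
open import Data.List.Membership.Propositional using (_∈_; lose)
open import Data.List.Membership.Propositional.Properties using (∈-map⁺; ∈-allFin; ∈-concatMap⁺)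
open import Data.List.Properties using (map-++; map-tabulate)
open import Data.List.Relation.Unary.Any using (here; there)
open import Data.Maybe using (Maybe; just; nothing; is-just)
open import Data.Maybe.Properties using (just-injective; ≡-dec)
open import Data.Nat using (zero; suc; _+_; _∸_; _≤_; _<_; z≤n; s≤s)
open import Data.Nat.ListAction using (sum)
open import Data.Nat.ListAction.Properties using (sum-++)
open import Data.Nat.Properties
open import Algebra.Properties.CommutativeSemigroup +-commutativeSemigroup using (interchange)
open import Data.Product using (_×_; _,_; Σ; ∃; proj₁; proj₂)
open import Data.Sum using (inj₁; inj₂)
open import Data.Vec using (lookup; []; _∷_)
import Data.Vec.Functional as VF
open import Function using (_∘_)
open import Function.Bundles using (mk⇔)
open import Relation.Binary.Definitions using (tri<; tri≈; tri>)
open import Relation.Binary.PropositionalEquality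
open import Relation.Nullary using (Dec; does; yes; no; ¬_)
open import Relation.Nullary.Decidable using (_×-dec_; ¬?)

∑ : ∀ {A : Set} → (A → ℕ) → List A → ℕ
∑ h xs = sum (map h xs)

∑-cong : ∀ {A : Set} {h h′ : A → ℕ} (xs : List A) → h ≗ h′ → ∑ h xs ≡ ∑ h′ xs
∑-cong []       e = refl
∑-cong (x ∷ xs) e = cong₂ _+_ (e x) (∑-cong xs e)

∑-++ : ∀ {A : Set} (h : A → ℕ) (xs ys : List A) → ∑ h (xs ++ ys) ≡ ∑ h xs + ∑ h ys
∑-++ h xs ys = trans (cong sum (map-++ h xs ys)) (sum-++ (map h xs) (map h ys))

∑-map : ∀ {A B : Set} (h : B → ℕ) (g : A → B) (xs : List A) → ∑ h (map g xs) ≡ ∑ (h ∘ g) xs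
∑-map h g []       = refl
∑-map h g (x ∷ xs) = cong (h (g x) +_) (∑-map h g xs)

∑-concatMap : ∀ {A B : Set} (h : B → ℕ) (g : A → List B) (xs : List A) →
  ∑ h (concatMap g xs) ≡ ∑ (λ x → ∑ h (g x)) xs
∑-concatMap h g []       = refl
∑-concatMap h g (x ∷ xs) =
  trans (∑-++ h (g x) (concatMap g xs)) (cong (∑ h (g x) +_) (∑-concatMap h g xs))

∑-zero : ∀ {A : Set} (xs : List A) → ∑ (λ _ → 0) xs ≡ 0
∑-zero []       = refl
∑-zero (x ∷ xs) = ∑-zero xs

∑-+ : ∀ {A : Set} (h h′ : A → ℕ) (xs : List A) → ∑ (λ x → h x + h′ x) xs ≡ ∑ h xs + ∑ h′ xs
∑-+ h h′ []       = refl
∑-+ h h′ (x ∷ xs) =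
  trans (cong (h x + h′ x +_) (∑-+ h h′ xs)) (interchange (h x) (h′ x) (∑ h xs) (∑ h′ xs))

∑-comm : ∀ {A B : Set} (k : A → B → ℕ) (xs : List A) (ys : List B) →
  ∑ (λ x → ∑ (k x) ys) xs ≡ ∑ (λ y → ∑ (λ x → k x y) xs) ys
∑-comm k []       ys = sym (∑-zero ys)
∑-comm k (x ∷ xs) ys =
  trans (cong (∑ (k x) ys +_) (∑-comm k xs ys)) (sym (∑-+ (k x) (λ y → ∑ (λ x′ → k x′ y) xs) ys))

∑-allFin-suc : ∀ {n} (h : Fin (suc n) → ℕ) → ∑ h (allFin (suc n)) ≡ h fz + ∑ (h ∘ fs) (allFin n)
∑-allFin-suc {n} h = cong (h fz +_) (trans (cong sum (map-tabulate fs h))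
                                           (sym (cong sum (map-tabulate (λ i → i) (h ∘ fs)))))

∑-mono : ∀ {A : Set} {h h′ : A → ℕ} (xs : List A) → (∀ x → h x ≤ h′ x) → ∑ h xs ≤ ∑ h′ xs
∑-mono []       le = z≤n
∑-mono (x ∷ xs) le = +-mono-≤ (le x) (∑-mono xs le)

∑-mono-< : ∀ {A : Set} {h h′ : A → ℕ} (xs : List A) → (∀ x → h x ≤ h′ x) →
  ∀ {x₀} → x₀ ∈ xs → h x₀ < h′ x₀ → ∑ h xs < ∑ h′ xs
∑-mono-< (x ∷ xs) le (here refl) lt = +-mono-<-≤ lt (∑-mono xs le)
∑-mono-< (x ∷ xs) le (there m)   lt = +-mono-≤-< (le x) (∑-mono-< xs le m lt)

∑≡0⇒ : ∀ {A : Set} (h : A → ℕ) (xs : List A) → ∑ h xs ≡ 0 → ∀ {x} → x ∈ xs → h x ≡ 0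
∑≡0⇒ h (y ∷ xs) e (here refl) = m+n≡0⇒m≡0 (h y) e
∑≡0⇒ h (y ∷ xs) e (there m)   = ∑≡0⇒ h xs (m+n≡0⇒n≡0 (h y) e) m

∑-≤ : ∀ {A : Set} (h : A → ℕ) (xs : List A) {x} → x ∈ xs → h x ≤ ∑ h xs
∑-≤ h (y ∷ xs) (here refl) = m≤m+n (h y) _
∑-≤ h (y ∷ xs) (there m)   = ≤-trans (∑-≤ h xs m) (m≤n+m _ (h y))

𝟙 : ∀ {P : Set} → Dec P → ℕ
𝟙 d = if does d then 1 else 0

count : ∀ {A : Set} {P : A → Set} → (∀ x → Dec (P x)) → List A → ℕ
count P? xs = length (filter P? xs)

count≡∑𝟙 : ∀ {A : Set} {P : A → Set} (P? : ∀ x → Dec (P x)) (xs : List A) →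
  count P? xs ≡ ∑ (λ x → 𝟙 (P? x)) xs
count≡∑𝟙 P? []       = refl
count≡∑𝟙 P? (x ∷ xs) with does (P? x)
... | true  = cong suc (count≡∑𝟙 P? xs)
... | false = count≡∑𝟙 P? xs

if-yes : ∀ {A P : Set} (d : Dec P) {x y : A} → P → (if does d then x else y) ≡ x
if-yes (yes _) _ = refl
if-yes (no ¬p) p = ⊥-elim (¬p p)

if-no : ∀ {A P : Set} (d : Dec P) {x y : A} → ¬ P → (if does d then x else y) ≡ y
if-no (yes p) ¬p = ⊥-elim (¬p p)
if-no (no _)  _  = refl

𝟙-pos : ∀ {P : Set} (d : Dec P) → 0 < 𝟙 d → P
𝟙-pos (yes p) _ = p
𝟙-pos (no _)  ()

does-⇔ : ∀ {P Q : Set} (p : Dec P) (q : Dec Q) → (P → Q) → (Q → P) → does p ≡ does q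
does-⇔ (yes _) (yes _) f g = refl
does-⇔ (no _)  (no _)  f g = refl
does-⇔ (yes p) (no ¬q) f g = ⊥-elim (¬q (f p))
does-⇔ (no ¬p) (yes q) f g = ⊥-elim (¬p (g q))

𝟙-⇔ : ∀ {P Q : Set} (p : Dec P) (q : Dec Q) → (P → Q) → (Q → P) → 𝟙 p ≡ 𝟙 q
𝟙-⇔ p q f g = cong (λ b → if b then 1 else 0) (does-⇔ p q f g)

𝟙-mono : ∀ {P Q : Set} (p : Dec P) (q : Dec Q) → (P → Q) → 𝟙 p ≤ 𝟙 q
𝟙-mono (yes p) q f = ≤-reflexive (sym (if-yes q (f p)))
𝟙-mono (no _)  q f = z≤n

count-cong : ∀ {A : Set} {P Q : A → Set} (P? : ∀ x → Dec (P x)) (Q? : ∀ x → Dec (Q x)) (xs : List A) →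
  (∀ x → P x → Q x) → (∀ x → Q x → P x) → count P? xs ≡ count Q? xs
count-cong P? Q? xs f g = begin
  count P? xs              ≡⟨ count≡∑𝟙 P? xs ⟩
  ∑ (λ x → 𝟙 (P? x)) xs    ≡⟨ ∑-cong xs (λ x → 𝟙-⇔ (P? x) (Q? x) (f x) (g x)) ⟩
  ∑ (λ x → 𝟙 (Q? x)) xs    ≡⟨ count≡∑𝟙 Q? xs ⟨
  count Q? xs              ∎
  where open ≡-Reasoning

count-pos : ∀ {A : Set} {P : A → Set} (P? : ∀ x → Dec (P x)) (xs : List A) → 0 < count P? xs → Σ A P
count-pos P? (x ∷ xs) lt with P? x
... | yes p = x , p
... | no _  = count-pos P? xs lt

count-∈ : ∀ {A : Set} {P : A → Set} (P? : ∀ x → Dec (P x)) (xs : List A) {x : A} →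
  x ∈ xs → P x → 0 < count P? xs
count-∈ P? xs x∈ p = subst (0 <_) (sym (count≡∑𝟙 P? xs))
  (≤-trans (≤-reflexive (sym (if-yes (P? _) p))) (∑-≤ (λ x → 𝟙 (P? x)) xs x∈))

count-unique : ∀ {n} {P : Fin n → Set} (P? : ∀ r → Dec (P r)) (i : Fin n) →
  (∀ r → P r → r ≡ i) → P i → count P? (allFin n) ≡ 1
count-unique {n} P? i u p = trans (count≡∑𝟙 P? (allFin n))
  (trans (∑-cong (allFin n) (λ r → 𝟙-⇔ (P? r) (r ≟ᶠ i) (u r) (λ { refl → p }))) (single i))
  where
  single : ∀ {m} (i : Fin m) → ∑ (λ r → 𝟙 (r ≟ᶠ i)) (allFin m) ≡ 1
  single {suc m} fz     = trans (∑-allFin-suc {m} (λ r → 𝟙 (r ≟ᶠ fz)))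
                                (cong suc (trans (∑-cong (allFin m) (λ _ → refl)) (∑-zero (allFin m))))
  single {suc m} (fs i) = trans (∑-allFin-suc {m} (λ r → 𝟙 (r ≟ᶠ fs i))) (single i)

count-none : ∀ {n} {P : Fin n → Set} (P? : ∀ r → Dec (P r)) → (∀ r → ¬ P r) → count P? (allFin n) ≡ 0
count-none {n} P? np = trans (count≡∑𝟙 P? (allFin n))
  (trans (∑-cong (allFin n) (λ r → if-no (P? r) (np r))) (∑-zero (allFin n)))

𝟙-< : ∀ {P Q : Set} (p : Dec P) (q : Dec Q) → ¬ P → Q → 𝟙 p < 𝟙 q
𝟙-< p q ¬p q′ = subst₂ _<_ (sym (if-no p ¬p)) (sym (if-yes q q′)) (s≤s z≤n)

count-< : ∀ {A : Set} {P Q : A → Set} (P? : ∀ x → Dec (P x)) (Q? : ∀ x → Dec (Q x)) (xs : List A) →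
  (∀ x → P x → Q x) → ∀ {x₀} → x₀ ∈ xs → ¬ P x₀ → Q x₀ → count P? xs < count Q? xs
count-< P? Q? xs P⇒Q x₀∈ ¬p q = subst₂ _<_ (sym (count≡∑𝟙 P? xs)) (sym (count≡∑𝟙 Q? xs))
  (∑-mono-< xs (λ x → 𝟙-mono (P? x) (Q? x) (P⇒Q x)) x₀∈ (𝟙-< (P? _) (Q? _) ¬p q))

allFuns-complete : ∀ {A : Set} (k : ℕ) (xs : List A) (R : A → A → Set) (f : Fin k → A) →
  (∀ t → Σ A (λ y → y ∈ xs × R y (f t))) →
  Σ (Fin k → A) (λ g → g ∈ allFuns k xs × (∀ t → R (g t) (f t)))
allFuns-complete zero    xs R f h = (λ ()) , here refl , λ ()
allFuns-complete (suc k) xs R f h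
  with h fz | allFuns-complete k xs R (f ∘ fs) (h ∘ fs)
... | y , y∈ , Ry | g , g∈ , Rg =
  (y VF.∷ g) , ∈-concatMap⁺ _ (lose y∈ (∈-map⁺ (y VF.∷_) g∈)) , λ { fz → Ry ; (fs t) → Rg t }

diagram-complete : ∀ M n (T : LDiagram M n) →
  Σ (LDiagram M n) (λ T′ → T′ ∈ allDiagrams M n × (∀ c → T′ c ≗ T c))
diagram-complete M n T = allFuns-complete M _ _≗_ T column
  where
  cell∈ : (m : Maybe (Fin n)) → m ∈ (nothing ∷ map just (allFin n))
  cell∈ nothing  = here refl
  cell∈ (just i) = there (∈-map⁺ just (∈-allFin i))
  column : ∀ c → Σ (Fin n → Maybe (Fin n)) (λ g → g ∈ allFuns n _ × g ≗ T c)
  column c with allFuns-complete n _ _≡_ (T c) (λ r → T c r , cell∈ (T c r) , refl)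
  ... | g , g∈ , e = g , g∈ , e

-- swap q exchanges the elements q and q+1 of Fin n (it is the identity if q+1 ≥ n).
swap : ∀ {n} → ℕ → Fin n → Fin n
swap {suc (suc n)} zero fz          = fs fz
swap {suc (suc n)} zero (fs fz)     = fz
swap {suc (suc n)} zero (fs (fs x)) = fs (fs x)
swap {suc zero}    zero x           = x
swap (suc q) fz     = fz
swap (suc q) (fs x) = fs (swap q x)

swap-involutive : ∀ {n} q (x : Fin n) → swap q (swap q x) ≡ x
swap-involutive {suc (suc n)} zero fz          = refl
swap-involutive {suc (suc n)} zero (fs fz)     = refl
swap-involutive {suc (suc n)} zero (fs (fs x)) = refl
swap-involutive {suc zero}    zero x           = refl
swap-involutive (suc q) fz     = refl
swap-involutive (suc q) (fs x) = cong fs (swap-involutive q x)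

data SwapView (q : ℕ) (x y : ℕ) : Set where
  at-q    : x ≡ q → y ≡ suc q → SwapView q x y
  at-sucq : x ≡ suc q → y ≡ q → SwapView q x y
  fixed   : x ≢ q → x ≢ suc q → y ≡ x → SwapView q x y

swap-view : ∀ {n} q (x : Fin n) → suc q < n → SwapView q (toℕ x) (toℕ (swap q x))
swap-view {suc (suc n)} zero fz          lt = at-q refl refl
swap-view {suc (suc n)} zero (fs fz)     lt = at-sucq refl refl
swap-view {suc (suc n)} zero (fs (fs x)) lt = fixed (λ ()) (λ ()) refl
swap-view {suc zero}    zero x (s≤s ())
swap-view {suc n} (suc q) fz     lt = fixed (λ ()) (λ ()) refl
swap-view {suc n} (suc q) (fs x) (s≤s lt) with swap-view q x lt
... | at-q e e′       = at-q (cong suc e) (cong suc e′)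
... | at-sucq e e′    = at-sucq (cong suc e) (cong suc e′)
... | fixed ne ne′ e  = fixed (ne ∘ suc-injective) (ne′ ∘ suc-injective) (cong suc e)

swap-at-q : ∀ {n} q (x : Fin n) → suc q < n → toℕ x ≡ q → toℕ (swap q x) ≡ suc q
swap-at-q q x lt e with swap-view q x lt
... | at-q _ e′      = e′
... | at-sucq e″ _   = ⊥-elim (<⇒≢ (n<1+n q) (trans (sym e) e″))
... | fixed ne _ _   = ⊥-elim (ne e)

swap-at-sucq : ∀ {n} q (x : Fin n) → suc q < n → toℕ x ≡ suc q → toℕ (swap q x) ≡ q
swap-at-sucq q x lt e with swap-view q x lt
... | at-q e″ _      = ⊥-elim (<⇒≢ (n<1+n q) (trans (sym e″) e))
... | at-sucq _ e′   = e′
... | fixed _ ne _   = ⊥-elim (ne e)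

swap-mono-≤ : ∀ {n} q (x y : Fin n) → suc q < n → toℕ x ≤ toℕ y →
  ¬ (toℕ x ≡ q × toℕ y ≡ suc q) → toℕ (swap q x) ≤ toℕ (swap q y)
swap-mono-≤ q x y lt le ex with swap-view q x lt | swap-view q y lt
... | at-q a b      | at-q c d      rewrite b | d = ≤-refl
... | at-q a b      | at-sucq c d   = ⊥-elim (ex (a , c))
... | at-q a b      | fixed c d e   rewrite b | e | a = ≤∧≢⇒< le (c ∘ sym)
... | at-sucq a b   | at-q c d      rewrite a | c = ⊥-elim (1+n≰n le)
... | at-sucq a b   | at-sucq c d   rewrite b | d = ≤-refl
... | at-sucq a b   | fixed c d e   rewrite b | e | a = ≤-trans (n≤1+n _) le
... | fixed a b c   | at-q d e      rewrite c | d | e = ≤-trans le (n≤1+n _)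
... | fixed a b c   | at-sucq d e   rewrite c | d | e = ≤-pred (≤∧≢⇒< le b)
... | fixed a b c   | fixed d e f   rewrite c | f = le

swap-mono-< : ∀ {n} q (x y : Fin n) → suc q < n → toℕ x < toℕ y →
  ¬ (toℕ x ≡ q × toℕ y ≡ suc q) → toℕ (swap q x) < toℕ (swap q y)
swap-mono-< q x y lt le ex with swap-view q x lt | swap-view q y lt
... | at-q a b      | at-q c d      rewrite a | c = ⊥-elim (n≮n _ le)
... | at-q a b      | at-sucq c d   = ⊥-elim (ex (a , c))
... | at-q a b      | fixed c d e   rewrite b | e | a = ≤∧≢⇒< le (d ∘ sym)
... | at-sucq a b   | at-q c d      rewrite a | c = ⊥-elim (n≮n _ (<-trans le (n<1+n _)))
... | at-sucq a b   | at-sucq c d   rewrite a | c = ⊥-elim (n≮n _ le)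
... | at-sucq a b   | fixed c d e   rewrite b | e | a = <-trans (n<1+n _) le
... | fixed a b c   | at-q d e      rewrite c | d | e = <-trans le (n<1+n _)
... | fixed a b c   | at-sucq d e   rewrite c | d | e = ≤∧≢⇒< (≤-pred le) a
... | fixed a b c   | fixed d e f   rewrite c | f = le

∑-allFin-swap : ∀ n q (h : Fin n → ℕ) → ∑ (h ∘ swap q) (allFin n) ≡ ∑ h (allFin n)
∑-allFin-swap zero          q       h = refl
∑-allFin-swap (suc zero)    zero    h = refl
∑-allFin-swap (suc (suc n)) zero    h = begin
  ∑ (h ∘ swap zero) (allFin (2 + n))                   ≡⟨ ∑-allFin-suc (h ∘ swap zero) ⟩
  h (fs fz) + ∑ (h ∘ swap zero ∘ fs) (allFin (suc n))  ≡⟨ cong (h (fs fz) +_) (∑-allFin-suc (h ∘ swap zero ∘ fs)) ⟩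
  h (fs fz) + (h fz + rest)                            ≡⟨ +-assoc (h (fs fz)) _ _ ⟨
  h (fs fz) + h fz + rest                              ≡⟨ cong (_+ rest) (+-comm (h (fs fz)) (h fz)) ⟩
  h fz + h (fs fz) + rest                              ≡⟨ +-assoc (h fz) _ _ ⟩
  h fz + (h (fs fz) + rest)                            ≡⟨ cong (h fz +_) (∑-allFin-suc (h ∘ fs)) ⟨
  h fz + ∑ (h ∘ fs) (allFin (suc n))                   ≡⟨ ∑-allFin-suc h ⟨
  ∑ h (allFin (2 + n))                                 ∎
  where
  open ≡-Reasoning
  rest = ∑ (h ∘ fs ∘ fs) (allFin n)
∑-allFin-swap (suc n) (suc q) h = begin
  ∑ (h ∘ swap (suc q)) (allFin (suc n))       ≡⟨ ∑-allFin-suc (h ∘ swap (suc q)) ⟩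
  h fz + ∑ (h ∘ fs ∘ swap q) (allFin n)       ≡⟨ cong (h fz +_) (∑-allFin-swap n q (h ∘ fs)) ⟩
  h fz + ∑ (h ∘ fs) (allFin n)                ≡⟨ ∑-allFin-suc h ⟨
  ∑ h (allFin (suc n))                        ∎
  where open ≡-Reasoning

Extensional : ∀ {k} {B : Set} → ((Fin k → B) → ℕ) → Set
Extensional h = ∀ f g → f ≗ g → h f ≡ h g

∑-allFuns-suc : ∀ {A : Set} (xs : List A) n (h : (Fin (suc n) → A) → ℕ) →
  ∑ h (allFuns (suc n) xs) ≡ ∑ (λ x → ∑ (λ g → h (x VF.∷ g)) (allFuns n xs)) xs
∑-allFuns-suc xs n h =
  trans (∑-concatMap h _ xs) (∑-cong xs (λ x → ∑-map h (x VF.∷_) (allFuns n xs)))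

∑-allFuns-swap : ∀ {A : Set} (xs : List A) n q (h : (Fin n → A) → ℕ) → Extensional h →
  ∑ (λ f → h (f ∘ swap q)) (allFuns n xs) ≡ ∑ h (allFuns n xs)
∑-allFuns-swap xs zero          q    h ext = cong (_+ 0) (ext _ _ (λ ()))
∑-allFuns-swap xs (suc zero)    zero h ext = refl
∑-allFuns-swap xs (suc (suc n)) zero h ext = begin
  ∑ (λ f → h (f ∘ swap zero)) (allFuns (2 + n) xs)
    ≡⟨ ∑-allFuns-suc xs (suc n) _ ⟩
  ∑ (λ x → ∑ (λ g → h ((x VF.∷ g) ∘ swap zero)) (allFuns (suc n) xs)) xs
    ≡⟨ ∑-cong xs (λ x → ∑-allFuns-suc xs n _) ⟩
  ∑ (λ x → ∑ (λ y → ∑ (λ g → h ((x VF.∷ y VF.∷ g) ∘ swap zero)) (allFuns n xs)) xs) xs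
    ≡⟨ ∑-cong xs (λ x → ∑-cong xs (λ y → ∑-cong (allFuns n xs) (λ g → ext _ _ exchange))) ⟩
  ∑ (λ x → ∑ (λ y → ∑ (λ g → h (y VF.∷ x VF.∷ g)) (allFuns n xs)) xs) xs
    ≡⟨ ∑-comm (λ x y → ∑ (λ g → h (y VF.∷ x VF.∷ g)) (allFuns n xs)) xs xs ⟩
  ∑ (λ y → ∑ (λ x → ∑ (λ g → h (y VF.∷ x VF.∷ g)) (allFuns n xs)) xs) xs
    ≡⟨ ∑-cong xs (λ y → ∑-allFuns-suc xs n _) ⟨
  ∑ (λ y → ∑ (λ g → h (y VF.∷ g)) (allFuns (suc n) xs)) xs
    ≡⟨ ∑-allFuns-suc xs (suc n) h ⟨
  ∑ h (allFuns (2 + n) xs) ∎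
  where
  open ≡-Reasoning
  exchange : ∀ {x y} {g : Fin n → _} → (x VF.∷ y VF.∷ g) ∘ swap zero ≗ y VF.∷ x VF.∷ g
  exchange fz = refl
  exchange (fs fz) = refl
  exchange (fs (fs t)) = refl
∑-allFuns-swap xs (suc n) (suc q) h ext = begin
  ∑ (λ f → h (f ∘ swap (suc q))) (allFuns (suc n) xs)
    ≡⟨ ∑-allFuns-suc xs n _ ⟩
  ∑ (λ x → ∑ (λ g → h ((x VF.∷ g) ∘ swap (suc q))) (allFuns n xs)) xs
    ≡⟨ ∑-cong xs (λ x → ∑-cong (allFuns n xs) (λ g → ext _ _ (λ { fz → refl ; (fs t) → refl }))) ⟩
  ∑ (λ x → ∑ (λ g → h (x VF.∷ (g ∘ swap q))) (allFuns n xs)) xs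
    ≡⟨ ∑-cong xs (λ x → ∑-allFuns-swap xs n q (λ g → h (x VF.∷ g))
                          (λ f g e → ext _ _ (λ { fz → refl ; (fs t) → e t }))) ⟩
  ∑ (λ x → ∑ (λ g → h (x VF.∷ g)) (allFuns n xs)) xs
    ≡⟨ ∑-allFuns-suc xs n h ⟨
  ∑ h (allFuns (suc n) xs) ∎
  where open ≡-Reasoning

Extensional₂ : ∀ {k n} {B : Set} → ((Fin k → Fin n → B) → ℕ) → Set
Extensional₂ H = ∀ F G → (∀ c → F c ≗ G c) → H F ≡ H G

∑-allFuns²-swap : ∀ {A : Set} (xs : List A) n q k (H : (Fin k → Fin n → A) → ℕ) → Extensional₂ H →
  ∑ (λ F → H (λ c → F c ∘ swap q)) (allFuns k (allFuns n xs)) ≡ ∑ H (allFuns k (allFuns n xs))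
∑-allFuns²-swap xs n q zero    H ext = cong (_+ 0) (ext _ _ (λ ()))
∑-allFuns²-swap xs n q (suc k) H ext = begin
  ∑ (λ F → H (λ c → F c ∘ swap q)) (allFuns (suc k) L)
    ≡⟨ ∑-allFuns-suc L k _ ⟩
  ∑ (λ f → ∑ (λ G → H (λ c → (f VF.∷ G) c ∘ swap q)) (allFuns k L)) L
    ≡⟨ ∑-cong L (λ f → ∑-cong (allFuns k L) (λ G → ext _ _ (λ { fz _ → refl ; (fs c) _ → refl }))) ⟩
  ∑ (λ f → ∑ (λ G → H ((f ∘ swap q) VF.∷ (λ c → G c ∘ swap q))) (allFuns k L)) L
    ≡⟨ ∑-cong L (λ f → ∑-allFuns²-swap xs n q k (λ G → H ((f ∘ swap q) VF.∷ G))
                          (λ F G e → ext _ _ (λ { fz _ → refl ; (fs c) t → e c t }))) ⟩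
  ∑ (λ f → ∑ (λ G → H ((f ∘ swap q) VF.∷ G)) (allFuns k L)) L
    ≡⟨ ∑-allFuns-swap xs n q (λ f → ∑ (λ G → H (f VF.∷ G)) (allFuns k L))
         (λ f g e → ∑-cong (allFuns k L) (λ G → ext _ _ (λ { fz t → e t ; (fs c) _ → refl }))) ⟩
  ∑ (λ f → ∑ (λ G → H (f VF.∷ G)) (allFuns k L)) L
    ≡⟨ ∑-allFuns-suc L k H ⟨
  ∑ H (allFuns (suc k) L) ∎
  where
  open ≡-Reasoning
  L = allFuns n xs

nothing≢just : ∀ {A : Set} {x : A} → nothing ≢ just x
nothing≢just ()

_≈_ : ∀ {M n} → LDiagram M n → LDiagram M n → Set
T ≈ T′ = ∀ c → T c ≗ T′ c

≈-sym : ∀ {M n} {T T′ : LDiagram M n} → T ≈ T′ → T′ ≈ T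
≈-sym e c r = sym (e c r)

σ : ∀ {M n} → ℕ → LDiagram M n → LDiagram M n
σ q T c = T c ∘ swap q

σ-involutive : ∀ {M n} q (T : LDiagram M n) → σ q (σ q T) ≈ T
σ-involutive q T c r = cong (T c) (swap-involutive q r)

labelAt? : ∀ {M n} (T : LDiagram M n) c i r → Dec (T c r ≡ just i)
labelAt? T c i r = ≡-dec _≟ᶠ_ (T c r) (just i)

occ-cong : ∀ {M n} {T T′ : LDiagram M n} → T ≈ T′ → ∀ c i → occ T c i ≡ occ T′ c i
occ-cong {n = n} {T} {T′} e c i =
  count-cong (labelAt? T c i) (labelAt? T′ c i) (allFin n) (λ r p → trans (sym (e c r)) p) (λ r p → trans (e c r) p)

wt-cong : ∀ {M n} {T T′ : LDiagram M n} → T ≈ T′ → ∀ r → wt T r ≡ wt T′ r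
wt-cong {M} e r = ∑-cong (allFin M) (λ c → cong (λ m → if is-just m then 1 else 0) (e c r))

IsLKT-cong : ∀ {n} (a : Vec ℕ n) {T T′ : LDiagram (maxPart a) n} → T ≈ T′ → IsLKT a T → IsLKT a T′
IsLKT-cong a e (c1 , c2 , c3 , c4) =
  (λ i c → trans (sym (occ-cong e c i)) (c1 i c)) ,
  (λ c r i p → c2 c r i (trans (e c r) p)) ,
  (λ i c c′ r r′ lt p p′ → c3 i c c′ r r′ lt (trans (e c r) p) (trans (e c′ r′) p′)) ,
  (λ c r r′ i j lt p p′ → c4 c r r′ i j lt (trans (e c r) p) (trans (e c r′) p′))

HasWeight-cong : ∀ {M n} {T T′ : LDiagram M n} → T ≈ T′ → ∀ b → HasWeight T b → HasWeight T′ b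
HasWeight-cong e b h r = trans (sym (wt-cong e r)) (h r)

occ-σ : ∀ {M n} q (T : LDiagram M n) c i → occ (σ q T) c i ≡ occ T c i
occ-σ {n = n} q T c i = begin
  occ (σ q T) c i                                ≡⟨ count≡∑𝟙 (labelAt? (σ q T) c i) (allFin n) ⟩
  ∑ (𝟙 ∘ labelAt? T c i ∘ swap q) (allFin n)     ≡⟨ ∑-allFin-swap n q (𝟙 ∘ labelAt? T c i) ⟩
  ∑ (𝟙 ∘ labelAt? T c i) (allFin n)              ≡⟨ count≡∑𝟙 (labelAt? T c i) (allFin n) ⟨
  occ T c i                                      ∎
  where open ≡-Reasoning

RowEmpty : ∀ {M n} → LDiagram M n → ℕ → Set
RowEmpty T q = ∀ c r → toℕ r ≡ q → T c r ≡ nothing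

RowLabelsExceed : ∀ {M n} → LDiagram M n → ℕ → Set
RowLabelsExceed T q = ∀ c r i → toℕ r ≡ q → T c r ≡ just i → suc q ≤ toℕ i

wt≡0⇒empty : ∀ {M n} (T : LDiagram M n) r → wt T r ≡ 0 → ∀ c → T c r ≡ nothing
wt≡0⇒empty {M} T r e c with T c r in eq
... | nothing = refl
... | just i with ∑≡0⇒ (λ c → if is-just (T c r) then 1 else 0) (allFin M) e (∈-allFin c)
...   | z rewrite eq = ⊥-elim (1+n≢0 z)

empty⇒wt≡0 : ∀ {M n} (T : LDiagram M n) r → (∀ c → T c r ≡ nothing) → wt T r ≡ 0
empty⇒wt≡0 {M} T r e =
  trans (∑-cong (allFin M) (λ c → cong (λ m → if is-just m then 1 else 0) (e c))) (∑-zero (allFin M))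

weight0⇒RowEmpty : ∀ {M n} (T : LDiagram M n) (b : Fin n → ℕ) → HasWeight T b →
  ∀ q → (∀ r → toℕ r ≡ q → b r ≡ 0) → RowEmpty T q
weight0⇒RowEmpty T b hw q b0 c r e = wt≡0⇒empty T r (trans (hw r) (b0 r e)) c

HasWeight-σ⁻¹ : ∀ {M n} q (T : LDiagram M n) (b : Fin n → ℕ) →
  HasWeight (σ q T) (b ∘ swap q) → HasWeight T b
HasWeight-σ⁻¹ q T b hw r =
  trans (cong (wt T) (sym (swap-involutive q r))) (trans (hw (swap q r)) (cong b (swap-involutive q r)))

-- Condition (1) holds because
-- σ q only permutes the cells of each column; (2) needs the hypothesis on row q, which
-- moves up to row q+1; (3) and (4) hold because swap q is monotone away from the pair
-- (q, q+1), and that pair never holds two cells of T in one column or for one label.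
σ-IsLKT : ∀ {n} (a : Vec ℕ n) q (T : LDiagram (maxPart a) n) → suc q < n → IsLKT a T →
  RowEmpty T q ⊎ RowEmpty T (suc q) → RowLabelsExceed T q → IsLKT a (σ q T)
σ-IsLKT {n} a q T lt (c1 , c2 , c3 , c4) oneEmpty exceed = d1 , d2 , d3 , d4
  where
  notBoth : ∀ c c′ r r′ i j → toℕ r ≡ q → toℕ r′ ≡ suc q → T c r ≡ just i → T c′ r′ ≡ just j → ⊥
  notBoth c c′ r r′ i j e e′ p p′ = refute oneEmpty
    where
    refute : RowEmpty T q ⊎ RowEmpty T (suc q) → ⊥
    refute (inj₁ empty) with () ← trans (sym (empty c r e)) p
    refute (inj₂ empty) with () ← trans (sym (empty c′ r′ e′)) p′
  d1 : Cond1 a (σ q T)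
  d1 i c = trans (occ-σ q T c i) (c1 i c)
  d2 : Cond2 (σ q T)
  d2 c r i p with swap-view q r lt
  ... | at-q x y     = ≤-trans (≤-trans (≤-reflexive x) (n≤1+n q)) (subst (_≤ toℕ i) y (c2 c (swap q r) i p))
  ... | at-sucq x y  = subst (_≤ toℕ i) (sym x) (exceed c (swap q r) i y p)
  ... | fixed _ _ z  = subst (_≤ toℕ i) z (c2 c (swap q r) i p)
  d3 : Cond3 (σ q T)
  d3 i c c′ r r′ clt p p′ =
    subst₂ _≤_ (cong toℕ (swap-involutive q r′)) (cong toℕ (swap-involutive q r))
      (swap-mono-≤ q (swap q r′) (swap q r) lt (c3 i c c′ (swap q r) (swap q r′) clt p p′)
        (λ (e , e′) → notBoth c′ c (swap q r′) (swap q r) i i e e′ p′ p))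
  d4 : Cond4 (σ q T)
  d4 c r r′ i j rlt p p′ =
    c4 c (swap q r) (swap q r′) i j
      (swap-mono-< q r r′ lt rlt (λ (e , e′) → notBoth c c (swap q r′) (swap q r) j i
            (swap-at-sucq q r′ lt e′) (swap-at-q q r lt e) p′ p))
      p p′

σ-IsLKT-emptyRow : ∀ {n} (a : Vec ℕ n) q (T : LDiagram (maxPart a) n) → suc q < n → IsLKT a T →
  RowEmpty T q → IsLKT a (σ q T)
σ-IsLKT-emptyRow a q T lt lkt empty =
  σ-IsLKT a q T lt lkt (inj₁ empty) (λ c r i e p → ⊥-elim (nothing≢just (trans (sym (empty c r e)) p)))

-- Counting diagrams with a property that only depends on the cells is unaffected by
-- first exchanging two rows, since σ q permutes the enumeration allDiagrams.
count-σ : ∀ {M n} {P : LDiagram M n → Set} (P? : ∀ T → Dec (P T)) →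
  (∀ T T′ → T ≈ T′ → P T → P T′) → ∀ q →
  count (P? ∘ σ q) (allDiagrams M n) ≡ count P? (allDiagrams M n)
count-σ {M} {n} P? resp q = begin
  count (P? ∘ σ q) (allDiagrams M n)          ≡⟨ count≡∑𝟙 (P? ∘ σ q) (allDiagrams M n) ⟩
  ∑ (λ T → 𝟙 (P? (σ q T))) (allDiagrams M n)  ≡⟨ ∑-allFuns²-swap _ n q M (𝟙 ∘ P?) respects ⟩
  ∑ (λ T → 𝟙 (P? T)) (allDiagrams M n)        ≡⟨ count≡∑𝟙 P? (allDiagrams M n) ⟨
  count P? (allDiagrams M n)                  ∎
  where
  open ≡-Reasoning
  respects : Extensional₂ (𝟙 ∘ P?)
  respects T T′ e = 𝟙-⇔ (P? T) (P? T′) (resp T T′ e) (resp T′ T (≈-sym e))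

IsLKTOfWeight? : ∀ {n} (a : Vec ℕ n) (b : Fin n → ℕ) (T : LDiagram (maxPart a) n) →
  Dec (IsLKT a T × HasWeight T b)
IsLKTOfWeight? a b T = isLKT? a T ×-dec hasWeight? T b

IsLKTOfWeight-cong : ∀ {n} (a : Vec ℕ n) (b : Fin n → ℕ) (T T′ : LDiagram (maxPart a) n) →
  T ≈ T′ → IsLKT a T × HasWeight T b → IsLKT a T′ × HasWeight T′ b
IsLKTOfWeight-cong a b T T′ e (l , h) = IsLKT-cong a e l , HasWeight-cong e b h

lockCoeff-cong : ∀ {n} (a : Vec ℕ n) {b b′ : Fin n → ℕ} → b ≗ b′ → lockCoeff a b ≡ lockCoeff a b′
lockCoeff-cong {n} a {b} {b′} e =
  count-cong (IsLKTOfWeight? a b) (IsLKTOfWeight? a b′) (allDiagrams (maxPart a) n)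
    (λ T (l , h) → l , λ r → trans (h r) (e r)) (λ T (l , h) → l , λ r → trans (h r) (sym (e r)))

lookup≤maxPart : ∀ {n} (a : Vec ℕ n) i → lookup a i ≤ maxPart a
lookup≤maxPart (x ∷ a) fz     = m≤m⊔n x _
lookup≤maxPart (x ∷ a) (fs i) = ≤-trans (lookup≤maxPart a i) (m≤n⊔m x _)

InRange : ∀ {n} (a : Vec ℕ n) → Fin (maxPart a) → Fin n → Set
InRange a c i = maxPart a ∸ lookup a i ≤ toℕ c

InRange? : ∀ {n} (a : Vec ℕ n) c i → Dec (InRange a c i)
InRange? a c i = maxPart a ∸ lookup a i ≤? toℕ c

label⇒InRange : ∀ {n} (a : Vec ℕ n) (T : LDiagram (maxPart a) n) → Cond1 a T →
  ∀ c r i → T c r ≡ just i → InRange a c i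
label⇒InRange {n} a T c1 c r i e = 𝟙-pos (InRange? a c i)
  (subst (0 <_) (c1 i c) (count-∈ (labelAt? T c i) (allFin n) (∈-allFin r) e))

InRange⇒label : ∀ {n} (a : Vec ℕ n) (T : LDiagram (maxPart a) n) → Cond1 a T →
  ∀ c i → InRange a c i → Σ (Fin n) (λ r → T c r ≡ just i)
InRange⇒label {n} a T c1 c i inR = count-pos (labelAt? T c i) (allFin n)
  (subst (0 <_) (sym (trans (c1 i c) (if-yes (InRange? a c i) inR))) (s≤s z≤n))

lastColumn : ∀ {M} → 0 < M → Σ (Fin M) (λ c → toℕ c ≡ M ∸ 1)
lastColumn {suc M} _ = fromℕ M , toℕ-fromℕ M

sameCell⇒sameLabel : ∀ {M n} (T : LDiagram M n) c {r r′ i j} → toℕ r ≡ toℕ r′ →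
  T c r ≡ just i → T c r′ ≡ just j → i ≡ j
sameCell⇒sameLabel T c r≡r′ p p′ = just-injective (trans (sym p) (trans (cong (T c) (toℕ-injective r≡r′)) p′))

-- The lifting property of a: in every lock tableau of content a whose row q+1 is empty,
-- all labels of row q exceed q.  It is what makes σ q a bijection in the proof of (⇐).
LiftingProperty : ∀ {n} → Vec ℕ n → Set
LiftingProperty {n} a = ∀ q (T : LDiagram (maxPart a) n) → suc q < n → IsLKT a T →
  RowEmpty T (suc q) → RowLabelsExceed T q

-- Weakly increasing contents have the lifting property: a label q in row q would force
-- label q+1, whose range contains that of q, into the same column; by (2) and (4) it
-- could then only sit in row q+1, which is empty.
weaklyIncreasing⇒lifting : ∀ {n} (a : Vec ℕ n) → WeaklyIncreasing a → LiftingProperty a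
weaklyIncreasing⇒lifting {n} a wi q T lt (c1 , c2 , _ , c4) empty c r i er p with toℕ i ≟ q
... | no i≢q  = ≤∧≢⇒< (subst (_≤ toℕ i) er (c2 c r i p)) (i≢q ∘ sym)
... | yes i≡q = ⊥-elim (noCellFor-q+1 (InRange⇒label a T c1 c i′ inRange′))
  where
  i′ : Fin n
  i′ = fromℕ< lt
  inRange′ : InRange a c i′
  inRange′ = ≤-trans (∸-monoʳ-≤ (maxPart a) (wi i i′ (subst₂ _≤_ (sym i≡q) (sym (toℕ-fromℕ< lt)) (n≤1+n q))))
                     (label⇒InRange a T c1 c r i p)
  -- label q+1 lies weakly below row q+1 by (2), hence weakly below row q as row q+1 is empty
  belowRow-q : ∀ ρ → T c ρ ≡ just i′ → toℕ ρ ≤ toℕ r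
  belowRow-q ρ pρ = subst (toℕ ρ ≤_) (sym er) (≤-pred (≤∧≢⇒< ρ≤q+1 (λ e → nothing≢just (trans (sym (empty c ρ e)) pρ))))
    where
    ρ≤q+1 : toℕ ρ ≤ suc q
    ρ≤q+1 = subst (toℕ ρ ≤_) (toℕ-fromℕ< lt) (c2 c ρ i′ pρ)
  noCellFor-q+1 : Σ (Fin n) (λ ρ → T c ρ ≡ just i′) → ⊥
  noCellFor-q+1 (ρ , pρ) with m≤n⇒m<n∨m≡n (belowRow-q ρ pρ)
  ... | inj₁ ρ<r = <-asym (subst₂ _<_ (toℕ-fromℕ< lt) i≡q (c4 c ρ r i′ i ρ<r pρ p)) (n<1+n q)
  ... | inj₂ ρ≡r = <⇒≢ (n<1+n q)
                     (trans (sym i≡q) (trans (cong toℕ (sameCell⇒sameLabel T c (sym ρ≡r) p pρ)) (toℕ-fromℕ< lt)))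

-- With no zero parts every label occurs in the last column, and there label m sits at
-- least m rows up: the labels below it are smaller by (4).
labelsClimbLastColumn : ∀ {n} (a : Vec ℕ n) → NoZeroParts a → (T : LDiagram (maxPart a) n) → IsLKT a T →
  (cM : Fin (maxPart a)) → toℕ cM ≡ maxPart a ∸ 1 →
  ∀ m (ml : m < n) → Σ (Fin n) (λ ρ → T cM ρ ≡ just (fromℕ< ml) × m ≤ toℕ ρ)
labelsClimbLastColumn a nz T (c1 , _ , _ , c4) cM ecM = climb
  where
  present : ∀ i → Σ _ (λ ρ → T cM ρ ≡ just i)
  present i = InRange⇒label a T c1 cM i (subst (maxPart a ∸ lookup a i ≤_) (sym ecM) (∸-monoʳ-≤ (maxPart a) (nz i)))
  climb : ∀ m (ml : m < _) → Σ _ (λ ρ → T cM ρ ≡ just (fromℕ< ml) × m ≤ toℕ ρ)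
  climb zero    ml = let (ρ , pρ) = present (fromℕ< ml) in ρ , pρ , z≤n
  climb (suc m) ml with climb m (<-trans (n<1+n m) ml) | present (fromℕ< ml)
  ... | ρ , pρ , m≤ρ | ρ′ , pρ′ with <-cmp (toℕ ρ′) (toℕ ρ)
  ...   | tri< l _ _ = ⊥-elim (<-asym (subst₂ _<_ (toℕ-fromℕ< ml) (toℕ-fromℕ< _) (c4 cM ρ′ ρ _ _ l pρ′ pρ))
                                      (n<1+n m))
  ...   | tri≈ _ e _ = ⊥-elim (<⇒≢ (n<1+n m) (trans (sym (toℕ-fromℕ< (<-trans (n<1+n m) ml)))
                         (trans (cong toℕ (sameCell⇒sameLabel T cM (sym e) pρ pρ′)) (toℕ-fromℕ< ml))))
  ...   | tri> _ _ g = ρ′ , pρ′ , ≤-trans (s≤s m≤ρ) g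

-- Contents without zero parts have the lifting property vacuously: by (2) label q+1 sits
-- exactly in row q+1 of the last column, so that row is never empty.
noZeroParts⇒lifting : ∀ {n} (a : Vec ℕ n) → NoZeroParts a → LiftingProperty a
noZeroParts⇒lifting a nz q T lt lkt@(_ , c2 , _) empty c r i er p
  with lastColumn (≤-trans (nz (fromℕ< lt)) (lookup≤maxPart a (fromℕ< lt)))
... | cM , ecM with labelsClimbLastColumn a nz T lkt cM ecM (suc q) lt
...   | ρ , pρ , q+1≤ρ = ⊥-elim (nothing≢just (trans (sym (empty cM ρ ρ≡q+1)) pρ))
  where
  ρ≡q+1 : toℕ ρ ≡ suc q
  ρ≡q+1 = ≤-antisym (subst (toℕ ρ ≤_) (toℕ-fromℕ< lt) (c2 cM ρ _ pρ)) q+1≤ρ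

-- Under the lifting property, exchanging rows q and q+1 is a bijection from lock tableaux
-- of weight b with b_q = 0 onto those of weight b ∘ swap q.  Hence the two coefficients agree.
lockCoeff-swap : ∀ {n} (a : Vec ℕ n) → LiftingProperty a → ∀ q (b : Fin n → ℕ) → suc q < n →
  (∀ r → toℕ r ≡ q → b r ≡ 0) → lockCoeff a b ≡ lockCoeff a (b ∘ swap q)
lockCoeff-swap {n} a lifting q b lt b0 = begin
  lockCoeff a b
    ≡⟨ count-cong (IsLKTOfWeight? a b) (IsLKTOfWeight? a b′ ∘ σ q) D to from ⟩
  count (IsLKTOfWeight? a b′ ∘ σ q) D
    ≡⟨ count-σ (IsLKTOfWeight? a b′) (IsLKTOfWeight-cong a b′) q ⟩
  lockCoeff a b′ ∎
  where
  open ≡-Reasoning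
  D = allDiagrams (maxPart a) n
  b′ : Fin n → ℕ
  b′ = b ∘ swap q
  to : ∀ T → IsLKT a T × HasWeight T b → IsLKT a (σ q T) × HasWeight (σ q T) b′
  to T (lkt , hw) = σ-IsLKT-emptyRow a q T lt lkt (weight0⇒RowEmpty T b hw q b0) , hw ∘ swap q
  from : ∀ T → IsLKT a (σ q T) × HasWeight (σ q T) b′ → IsLKT a T × HasWeight T b
  from T (lkt , hw) = IsLKT-cong a (σ-involutive q T) lkt′ , HasWeight-σ⁻¹ q T b hw
    where
    empty : RowEmpty (σ q T) (suc q)
    empty = weight0⇒RowEmpty (σ q T) b′ hw (suc q) (λ r e → b0 (swap q r) (swap-at-sucq q r lt e))
    lkt′ : IsLKT a (σ q (σ q T))
    lkt′ = σ-IsLKT a q (σ q T) lt lkt (inj₂ empty) (lifting q (σ q T) lt lkt empty)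

monomial-suc : ∀ {k n} (i : Fin (suc k) → Fin n) b r →
  monomial i b r ≡ (if does (i fz ≟ᶠ r) then b fz else 0) + monomial (i ∘ fs) (b ∘ fs) r
monomial-suc i b r = ∑-allFin-suc (λ t → if does (i t ≟ᶠ r) then b t else 0)

monomial-absent : ∀ {k n} (i : Fin k → Fin n) b r → (∀ t → i t ≢ r) → monomial i b r ≡ 0
monomial-absent {k} i b r ne =
  trans (∑-cong (allFin k) (λ t → if-no (i t ≟ᶠ r) (ne t))) (∑-zero (allFin k))

monomial-≥ : ∀ {k n} (i : Fin k → Fin n) b t → b t ≤ monomial i b (i t)
monomial-≥ {k} i b t = ≤-trans (≤-reflexive (sym (if-yes (i t ≟ᶠ i t) refl)))
  (∑-≤ (λ s → if does (i s ≟ᶠ i t) then b s else 0) (allFin k) (∈-allFin t))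

StrictlyIncreasing⇒injective : ∀ {k n} (i : Fin k → Fin n) → StrictlyIncreasing i → ∀ {s t} → i s ≡ i t → s ≡ t
StrictlyIncreasing⇒injective i st {s} {t} e with <-cmp (toℕ s) (toℕ t)
... | tri< l _ _ = ⊥-elim (<-irrefl (cong toℕ e) (st s t l))
... | tri≈ _ x _ = toℕ-injective x
... | tri> _ _ g = ⊥-elim (<-irrefl (cong toℕ (sym e)) (st t s g))

shiftDown : ∀ {k n} (i : Fin k → Fin (suc n)) → (∀ t → i t ≢ fz) → Fin k → Fin n
shiftDown i nz t = punchOut (nz t ∘ sym)

fs∘shiftDown : ∀ {k n} (i : Fin k → Fin (suc n)) nz t → fs (shiftDown i nz t) ≡ i t
fs∘shiftDown i nz t = punchIn-punchOut (nz t ∘ sym)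

shiftDown-strict : ∀ {k n} (i : Fin k → Fin (suc n)) nz → StrictlyIncreasing i → StrictlyIncreasing (shiftDown i nz)
shiftDown-strict i nz st s t l =
  ≤-pred (subst₂ _<_ (sym (cong toℕ (fs∘shiftDown i nz s))) (sym (cong toℕ (fs∘shiftDown i nz t))) (st s t l))

monomial-shiftDown : ∀ {k n} (i : Fin k → Fin (suc n)) nz b r → monomial i b (fs r) ≡ monomial (shiftDown i nz) b r
monomial-shiftDown {k} i nz b r = ∑-cong (allFin k)
  (λ t → cong (λ x → if does (x ≟ᶠ fs r) then b t else 0) (sym (fs∘shiftDown i nz t)))

canonical : (k n : ℕ) → (Fin k → ℕ) → Fin n → ℕ
canonical zero    n       b _ = 0
canonical (suc k) zero    b ()
canonical (suc k) (suc n) b = b fz VF.∷ canonical k n (b ∘ fs)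

ZeroShiftInvariant : (n : ℕ) → ((Fin n → ℕ) → ℕ) → Set
ZeroShiftInvariant n f =
  Extensional f ×
  (∀ q e → suc q < n → (∀ r → toℕ r ≡ q → e r ≡ 0) → f e ≡ f (e ∘ swap q))

ZeroShiftInvariant-tail : ∀ n f → ZeroShiftInvariant (suc n) f → ∀ x → ZeroShiftInvariant n (λ e → f (x VF.∷ e))
ZeroShiftInvariant-tail n f (ext , shift) x =
  (λ e e′ p → ext _ _ (λ { fz → refl ; (fs r) → p r })) ,
  (λ q e lt e0 → trans (shift (suc q) (x VF.∷ e) (s≤s lt) (λ { fz () ; (fs r) p → e0 r (suc-injective p) }))
                       (ext _ _ (λ { fz → refl ; (fs r) → refl })))

leadingZero-shift : ∀ n f → ZeroShiftInvariant (suc n) f → ∀ k b → k ≤ n →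
  f (0 VF.∷ canonical k n b) ≡ f (canonical k (suc n) b)
leadingZero-shift n       f (ext , _) zero b _ = ext _ _ (λ { fz → refl ; (fs r) → refl })
leadingZero-shift (suc n) f inv@(ext , shift) (suc k) b (s≤s k≤n) = begin
  f (0 VF.∷ b fz VF.∷ canonical k n (b ∘ fs))
    ≡⟨ shift zero _ (s≤s (s≤s z≤n)) (λ { fz _ → refl ; (fs r) () }) ⟩
  f ((0 VF.∷ b fz VF.∷ canonical k n (b ∘ fs)) ∘ swap zero)
    ≡⟨ ext _ _ (λ { fz → refl ; (fs fz) → refl ; (fs (fs r)) → refl }) ⟩
  f (b fz VF.∷ 0 VF.∷ canonical k n (b ∘ fs))
    ≡⟨ leadingZero-shift n _ (ZeroShiftInvariant-tail (suc n) f inv (b fz)) k (b ∘ fs) k≤n ⟩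
  f (canonical (suc k) (suc (suc n)) b) ∎
  where open ≡-Reasoning

-- The monomial with exponents b at strictly increasing positions i has the same invariant
-- coefficient as the canonical one: position 0 is either i_0, and we recurse on the rest,
-- or it carries exponent 0, which is shifted behind the k nonzero exponents.
invariant-canonical : ∀ n f → ZeroShiftInvariant n f → ∀ k (i : Fin k → Fin n) b →
  StrictlyIncreasing i → f (monomial i b) ≡ f (canonical k n b)
invariant-canonical zero    f (ext , _) k       i b st = ext _ _ (λ ())
invariant-canonical (suc n) f (ext , _) zero    i b st = ext _ _ (λ _ → refl)
invariant-canonical (suc n) f inv@(ext , _) (suc k) i b st with i fz ≟ᶠ fz
... | yes i₀≡1 = trans (ext _ _ head) (invariant-canonical n _ (ZeroShiftInvariant-tail n f inv (b fz)) k i′ (b ∘ fs) st′)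
  where
  nz : ∀ t → i (fs t) ≢ fz
  nz t e = <-irrefl (cong toℕ (trans i₀≡1 (sym e))) (st fz (fs t) (s≤s z≤n))
  i′ = shiftDown (i ∘ fs) nz
  st′ : StrictlyIncreasing i′
  st′ = shiftDown-strict (i ∘ fs) nz (λ s t l → st (fs s) (fs t) (s≤s l))
  first : ∀ r → monomial i b r ≡ (if does (fz ≟ᶠ r) then b fz else 0) + monomial (i ∘ fs) (b ∘ fs) r
  first r = trans (monomial-suc i b r)
                  (cong (λ x → (if does (x ≟ᶠ r) then b fz else 0) + monomial (i ∘ fs) (b ∘ fs) r) i₀≡1)
  head : monomial i b ≗ b fz VF.∷ monomial i′ (b ∘ fs)
  head fz     = trans (first fz) (trans (cong (b fz +_) (monomial-absent (i ∘ fs) (b ∘ fs) fz nz)) (+-identityʳ _))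
  head (fs r) = trans (first (fs r)) (monomial-shiftDown (i ∘ fs) nz (b ∘ fs) r)
... | no i₀≢1 = begin
  f (monomial i b)
    ≡⟨ ext _ _ head ⟩
  f (0 VF.∷ monomial i′ b)
    ≡⟨ invariant-canonical n _ (ZeroShiftInvariant-tail n f inv 0) (suc k) i′ b st′ ⟩
  f (0 VF.∷ canonical (suc k) n b)
    ≡⟨ leadingZero-shift n f inv (suc k) b (injective⇒≤ (StrictlyIncreasing⇒injective i′ st′)) ⟩
  f (canonical (suc k) (suc n) b) ∎
  where
  open ≡-Reasoning
  nz : ∀ t → i t ≢ fz
  nz fz     e = i₀≢1 e
  nz (fs t) e = n≮0 (subst (toℕ (i fz) <_) (cong toℕ e) (st fz (fs t) (s≤s z≤n)))
  i′ = shiftDown i nz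
  st′ : StrictlyIncreasing i′
  st′ = shiftDown-strict i nz st
  head : monomial i b ≗ 0 VF.∷ monomial i′ b
  head fz     = monomial-absent i b fz nz
  head (fs r) = monomial-shiftDown i nz b r

ZeroShiftInvariant⇒QuasiSymmetric : ∀ n f → ZeroShiftInvariant n f → QuasiSymmetric n f
ZeroShiftInvariant⇒QuasiSymmetric n f inv k b i j _ si sj =
  trans (invariant-canonical n f inv k i b si) (sym (invariant-canonical n f inv k j b sj))

-- Every exponent vector is a monomial with positive exponents b at strictly increasing
-- positions i (the support of the vector, in order).
asMonomial : ∀ n (e : Fin n → ℕ) → Σ ℕ λ k → Σ (Fin k → ℕ) λ b → Σ (Fin k → Fin n) λ i →
  (∀ t → 0 < b t) × StrictlyIncreasing i × monomial i b ≗ e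
asMonomial zero    e = 0 , (λ ()) , (λ ()) , (λ ()) , (λ ()) , (λ ())
asMonomial (suc n) e with asMonomial n (e ∘ fs) | e fz in e₀
... | k , b , i , pos , st , eq | zero =
  k , b , fs ∘ i , pos , (λ s t l → s≤s (st s t l)) ,
  λ { fz → trans (monomial-absent (fs ∘ i) b fz (λ t ())) (sym e₀) ; (fs r) → eq r }
... | k , b , i , pos , st , eq | suc m =
  suc k , (suc m VF.∷ b) , (fz VF.∷ fs ∘ i) ,
  (λ { fz → s≤s z≤n ; (fs t) → pos t }) ,
  (λ { fz fz () ; fz (fs t) l → s≤s z≤n ; (fs s) fz () ; (fs s) (fs t) (s≤s l) → s≤s (st s t l) }) ,
  λ { fz → trans (monomial-suc (fz VF.∷ fs ∘ i) (suc m VF.∷ b) fz)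
                 (trans (cong (suc m +_) (monomial-absent (fs ∘ i) b fz (λ t ()))) (trans (+-identityʳ _) (sym e₀)))
    ; (fs r) → trans (monomial-suc (fz VF.∷ fs ∘ i) (suc m VF.∷ b) (fs r)) (eq r) }

-- A quasisymmetric coefficient function is unchanged when a zero exponent at position q+1
-- is moved to position q: the support avoids q+1, so swap q keeps it increasing.
QuasiSymmetric⇒zeroShift : ∀ {n} (f : (Fin n → ℕ) → ℕ) → QuasiSymmetric n f → Extensional f →
  ∀ q (e : Fin n → ℕ) → suc q < n → (∀ r → toℕ r ≡ suc q → e r ≡ 0) → f e ≡ f (e ∘ swap q)
QuasiSymmetric⇒zeroShift {n} f qs ext q e lt e0 with asMonomial n e
... | k , b , i , pos , st , eq =
  trans (ext _ _ (sym ∘ eq)) (trans (qs k b i j pos st sj) (ext _ _ swapped))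
  where
  j : Fin k → Fin n
  j = swap q ∘ i
  avoids : ∀ t → toℕ (i t) ≢ suc q
  avoids t e′ = <-irrefl refl (≤-trans (pos t) (≤-trans (monomial-≥ i b t) (≤-reflexive (trans (eq (i t)) (e0 (i t) e′)))))
  sj : StrictlyIncreasing j
  sj s t l = swap-mono-< q (i s) (i t) lt (st s t l) (λ (_ , e′) → avoids t e′)
  swapped : monomial j b ≗ e ∘ swap q
  swapped r = trans (∑-cong (allFin k) (λ t → cong (λ d → if d then b t else 0)
                 (does-⇔ (swap q (i t) ≟ᶠ r) (i t ≟ᶠ swap q r)
                    (λ p → trans (sym (swap-involutive q (i t))) (cong (swap q) p))
                    (λ p → trans (cong (swap q) p) (swap-involutive q r)))))
              (eq (swap q r))

-- A separating tableau for a: a lock tableau whose row q+1 is empty while the cell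
-- (c₀, r₀) in row q carries label q.  Its existence rules out quasisymmetry.
record Separating {n} (a : Vec ℕ n) : Set where
  field
    q        : ℕ
    q+1<n    : suc q < n
    T        : LDiagram (maxPart a) n
    isLKT    : IsLKT a T
    empty    : RowEmpty T (suc q)
    c₀       : Fin (maxPart a)
    r₀       : Fin n
    r₀≡q     : toℕ r₀ ≡ q
    ownLabel : T c₀ r₀ ≡ just r₀

-- Exchanging rows q and q+1 injects the lock tableaux of weight wt(T) ∘ swap q into
-- those of weight wt(T) (row q of the former is empty), but T itself is not hit: σ q T
-- has label q in row q+1, violating (2).
separating⇒coeff-< : ∀ {n} (a : Vec ℕ n) (S : Separating a) →
  let open Separating S in lockCoeff a (wt T ∘ swap q) < lockCoeff a (wt T)
separating⇒coeff-< {n} a S = begin-strict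
  lockCoeff a w′
    ≡⟨ count-σ (IsLKTOfWeight? a w′) (IsLKTOfWeight-cong a w′) q ⟨
  count (IsLKTOfWeight? a w′ ∘ σ q) D
    <⟨ count-< (IsLKTOfWeight? a w′ ∘ σ q) (IsLKTOfWeight? a w) D unswap T′∈D σT′-not-LKT T′-LKT ⟩
  lockCoeff a w ∎
  where
  open Separating S
  open ≤-Reasoning
  D = allDiagrams (maxPart a) n
  w w′ : Fin n → ℕ
  w  = wt T
  w′ = w ∘ swap q
  unswap : ∀ U → IsLKT a (σ q U) × HasWeight (σ q U) w′ → IsLKT a U × HasWeight U w
  unswap U (lkt , hw) = IsLKT-cong a (σ-involutive q U) (σ-IsLKT-emptyRow a q (σ q U) q+1<n lkt emptyRow-q) ,
                        HasWeight-σ⁻¹ q U w hw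
    where
    emptyRow-q : RowEmpty (σ q U) q
    emptyRow-q = weight0⇒RowEmpty (σ q U) w′ hw q
      (λ r e → empty⇒wt≡0 T (swap q r) (λ c → empty c (swap q r) (swap-at-q q r q+1<n e)))
  T′ = proj₁ (diagram-complete (maxPart a) n T)
  T′∈D = proj₁ (proj₂ (diagram-complete (maxPart a) n T))
  T′≈T : T′ ≈ T
  T′≈T = proj₂ (proj₂ (diagram-complete (maxPart a) n T))
  T′-LKT : IsLKT a T′ × HasWeight T′ w
  T′-LKT = IsLKTOfWeight-cong a w T T′ (≈-sym T′≈T) (isLKT , λ _ → refl)
  σT′-not-LKT : ¬ (IsLKT a (σ q T′) × HasWeight (σ q T′) w′)
  σT′-not-LKT ((_ , c2 , _) , _) = <-irrefl (sym r₀≡q) (subst (_≤ toℕ r₀) (swap-at-q q r₀ q+1<n r₀≡q)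
     (c2 c₀ (swap q r₀) r₀ (trans (cong (T′ c₀) (swap-involutive q r₀)) (trans (T′≈T c₀ r₀) ownLabel))))

separating⇒¬QuasiSymmetric : ∀ {n} (a : Vec ℕ n) → Separating a → ¬ QuasiSymmetric n (lockCoeff a)
separating⇒¬QuasiSymmetric a S qs = <-irrefl (sym equal) (separating⇒coeff-< a S)
  where
  open Separating S
  equal : lockCoeff a (wt T) ≡ lockCoeff a (wt T ∘ swap q)
  equal = QuasiSymmetric⇒zeroShift (lockCoeff a) qs (λ e e′ → lockCoeff-cong a) q (wt T) q+1<n
            (λ r e → empty⇒wt≡0 T r (λ c → empty c r e))

zeroPart⇒¬InRange : ∀ {n} (a : Vec ℕ n) c i → lookup a i ≡ 0 → ¬ InRange a c i
zeroPart⇒¬InRange a c i z p = <-irrefl refl (≤-trans (toℕ<n c) (subst (_≤ toℕ c) (cong (maxPart a ∸_) z) p))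

firstColumn : ∀ {n} (a : Vec ℕ n) i → 0 < lookup a i →
  Σ (Fin (maxPart a)) (λ c → toℕ c ≡ maxPart a ∸ lookup a i)
firstColumn a i pos = fromℕ< first<M , toℕ-fromℕ< first<M
  where
  first<M : maxPart a ∸ lookup a i < maxPart a
  first<M = ∸-monoʳ-< {o = 0} pos (lookup≤maxPart a i)

Cond1-intro : ∀ {n} (a : Vec ℕ n) (T : LDiagram (maxPart a) n) →
  (∀ c r i → T c r ≡ just i → InRange a c i) →
  (∀ c i → InRange a c i → Σ (Fin n) (λ r → T c r ≡ just i)) →
  (∀ c r r′ i → T c r ≡ just i → T c r′ ≡ just i → r ≡ r′) → Cond1 a T
Cond1-intro a T inRange exists unique i c with InRange? a c i
... | yes p = let (ρ , pρ) = exists c i p in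
              trans (count-unique (labelAt? T c i) ρ (λ r e → unique c r ρ i e pρ) pρ) (sym (if-yes (InRange? a c i) p))
... | no ¬p = trans (count-none (labelAt? T c i) (λ r e → ¬p (inRange c r i e))) (sym (if-no (InRange? a c i) ¬p))

placeIf : ∀ {A P : Set} → Dec P → A → Maybe A
placeIf (yes _) x = just x
placeIf (no _)  x = nothing

placeIf-just : ∀ {A P : Set} (d : Dec P) (x y : A) → placeIf d x ≡ just y → x ≡ y × P
placeIf-just (yes p) x y e = just-injective e , p
placeIf-just (no _)  x y ()

placeIf-yes : ∀ {A P : Set} (d : Dec P) (x : A) → P → placeIf d x ≡ just x
placeIf-yes (yes _) x _ = refl
placeIf-yes (no ¬p) x p = ⊥-elim (¬p p)

module KeyDiagram {n} (a : Vec ℕ n) where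

  key : Fin (maxPart a) → Fin n → Maybe (Fin n)
  key c x = placeIf (InRange? a c x) x

  key-just : ∀ c x i → key c x ≡ just i → x ≡ i × InRange a c i
  key-just c x i e with placeIf-just (InRange? a c x) x i e
  ... | refl , p = refl , p

  key-InRange : ∀ c x → InRange a c x → key c x ≡ just x
  key-InRange c x = placeIf-yes (InRange? a c x) x

  key-IsLKT : IsLKT a key
  key-IsLKT = d1 , d2 , d3 , d4
    where
    d1 : Cond1 a key
    d1 = Cond1-intro a key (λ c r i e → proj₂ (key-just c r i e)) (λ c i p → i , key-InRange c i p)
           (λ c r r′ i e e′ → trans (proj₁ (key-just c r i e)) (sym (proj₁ (key-just c r′ i e′))))
    d2 : Cond2 key
    d2 c r i e with refl ← proj₁ (key-just c r i e) = ≤-refl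
    d3 : Cond3 key
    d3 i c c′ r r′ _ e e′ with refl ← proj₁ (key-just c r i e) | refl ← proj₁ (key-just c′ r′ i e′) = ≤-refl
    d4 : Cond4 key
    d4 c r r′ i j lt e e′ with refl ← proj₁ (key-just c r i e) | refl ← proj₁ (key-just c r′ j e′) = lt

  -- If a_r > 0 = a_{r+1}, the key diagram separates: row r+1 is empty and label r sits in row r.
  positiveThenZero⇒separating : ∀ (r r′ : Fin n) → toℕ r′ ≡ suc (toℕ r) → 0 < lookup a r → lookup a r′ ≡ 0 →
    Separating a
  positiveThenZero⇒separating r r′ r′≡r+1 pos a-r′≡0 = record
    { q = toℕ r ; q+1<n = subst (_< n) r′≡r+1 (toℕ<n r′) ; T = key ; isLKT = key-IsLKT
    ; empty = λ c ρ e → rowEmpty c ρ (toℕ-injective (trans e (sym r′≡r+1)))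
    ; c₀ = proj₁ (firstColumn a r pos) ; r₀ = r ; r₀≡q = refl
    ; ownLabel = key-InRange _ r (≤-reflexive (sym (proj₂ (firstColumn a r pos)))) }
    where
    rowEmpty : ∀ c ρ → ρ ≡ r′ → key c ρ ≡ nothing
    rowEmpty c ρ refl with key c ρ in eq
    ... | nothing = refl
    ... | just i with key-just c ρ i eq
    ...   | refl , p = ⊥-elim (zeroPart⇒¬InRange a c ρ a-r′≡0 p)

-- If a_0 = 0 and a_{q+1} < a_q, shift labels down: in the columns holding label q+1, the
-- labels 1, ..., q+1 move from their own rows down by one (label x+1 into row x) and
-- row q+1 is left empty; elsewhere the key diagram is kept.  Label q stays in row q of
-- the first column of q, which does not hold label q+1.
module ShiftedDiagram {n} (a : Vec ℕ n) (q q+1 : Fin n) (q+1≡ : toℕ q+1 ≡ suc (toℕ q))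
         (descent : lookup a q+1 < lookup a q) (firstZero : ∀ i → toℕ i ≡ 0 → lookup a i ≡ 0) where

  open KeyDiagram a

  Q : ℕ
  Q = toℕ q

  Q+1<n : suc Q < n
  Q+1<n = subst (_< n) q+1≡ (toℕ<n q+1)

  Shifted : Fin (maxPart a) → Set
  Shifted c = InRange a c q+1

  shifted-mono : ∀ c c′ → Shifted c → toℕ c < toℕ c′ → Shifted c′
  shifted-mono c c′ s l = ≤-trans s (<⇒≤ l)

  label : Fin (maxPart a) → Fin n → Fin n
  label c ρ with InRange? a c q+1 | toℕ ρ ≤? Q
  ... | yes _ | yes ρ≤Q = fromℕ< (≤-trans (s≤s (s≤s ρ≤Q)) Q+1<n)
  ... | _     | _       = ρ

  data LabelView (c : Fin (maxPart a)) (ρ : Fin n) : Fin n → Set where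
    up   : Shifted c → toℕ ρ ≤ Q → ∀ {x} → toℕ x ≡ suc (toℕ ρ) → LabelView c ρ x
    same : ¬ (Shifted c × toℕ ρ ≤ Q) → LabelView c ρ ρ

  label-view : ∀ c ρ → LabelView c ρ (label c ρ)
  label-view c ρ with InRange? a c q+1 | toℕ ρ ≤? Q
  ... | yes s | yes ρ≤Q = up s ρ≤Q (toℕ-fromℕ< _)
  ... | yes s | no ρ≰Q  = same (λ (_ , ρ≤Q) → ρ≰Q ρ≤Q)
  ... | no ¬s | _       = same (λ (s , _) → ¬s s)

  Allowed : Fin (maxPart a) → Fin n → Set
  Allowed c ρ = ¬ (Shifted c × toℕ ρ ≡ suc Q)

  shifted : LDiagram (maxPart a) n
  shifted c ρ with ¬? (InRange? a c q+1 ×-dec (toℕ ρ ≟ suc Q))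
  ... | yes _ = key c (label c ρ)
  ... | no _  = nothing

  shifted-just : ∀ c ρ i → shifted c ρ ≡ just i → Allowed c ρ × label c ρ ≡ i × InRange a c i
  shifted-just c ρ i e with ¬? (InRange? a c q+1 ×-dec (toℕ ρ ≟ suc Q))
  ... | yes allowed = allowed , key-just c (label c ρ) i e
  ... | no _ with () ← e

  shifted-filled : ∀ c ρ → Allowed c ρ → InRange a c (label c ρ) → shifted c ρ ≡ just (label c ρ)
  shifted-filled c ρ allowed p with ¬? (InRange? a c q+1 ×-dec (toℕ ρ ≟ suc Q))
  ... | yes _          = key-InRange c (label c ρ) p
  ... | no notAllowed  = ⊥-elim (notAllowed allowed)

  view-≥ : ∀ {c ρ x} → LabelView c ρ x → toℕ ρ ≤ toℕ x
  view-≥ {ρ = ρ} (up _ _ e) = subst (toℕ ρ ≤_) (sym e) (n≤1+n _)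
  view-≥ (same _)           = ≤-refl

  view-≤ : ∀ {c ρ x} → LabelView c ρ x → toℕ x ≤ suc (toℕ ρ)
  view-≤ (up _ _ e) = ≤-reflexive e
  view-≤ (same _)   = n≤1+n _

  label-< : ∀ c ρ ρ′ → Allowed c ρ′ → toℕ ρ < toℕ ρ′ → toℕ (label c ρ) < toℕ (label c ρ′)
  label-< c ρ ρ′ allowed l = increases (label-view c ρ) (label-view c ρ′)
    where
    increases : ∀ {x x′} → LabelView c ρ x → LabelView c ρ′ x′ → toℕ x < toℕ x′
    increases (up _ _ e)    (up _ _ e′) = subst₂ _<_ (sym e) (sym e′) (s≤s l)
    increases (up s ρ≤Q e)  (same ¬up′) = subst (_< toℕ ρ′) (sym e)
      (≤-trans (s≤s (s≤s ρ≤Q)) (≤∧≢⇒< (≰⇒> (λ ρ′≤Q → ¬up′ (s , ρ′≤Q))) (λ e′ → allowed (s , sym e′))))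
    increases (same _)      (up _ _ e′) = subst (toℕ ρ <_) (sym e′) (<-trans l (n<1+n _))
    increases (same _)      (same _)    = l

  label-injective : ∀ c ρ ρ′ → Allowed c ρ → Allowed c ρ′ → label c ρ ≡ label c ρ′ → ρ ≡ ρ′
  label-injective c ρ ρ′ al al′ e with <-cmp (toℕ ρ) (toℕ ρ′)
  ... | tri< l _ _ = ⊥-elim (<-irrefl (cong toℕ e) (label-< c ρ ρ′ al′ l))
  ... | tri≈ _ x _ = toℕ-injective x
  ... | tri> _ _ g = ⊥-elim (<-irrefl (cong toℕ (sym e)) (label-< c ρ′ ρ al g))

  -- every label in range is the label wanted in some allowed cell (label 0 never occurs)
  label-preimage : ∀ c i → InRange a c i → Σ (Fin n) (λ ρ → Allowed c ρ × label c ρ ≡ i)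
  label-preimage c i p = byCase (InRange? a c q+1) (toℕ i) refl
    where
    kept : (¬ Shifted c ⊎ Q < toℕ i) → ∀ {x} → LabelView c i x → x ≡ i
    kept (inj₁ ¬s)  (up s _ _)   = ⊥-elim (¬s s)
    kept (inj₂ Q<i) (up _ i≤Q _) = ⊥-elim (<-irrefl refl (<-≤-trans Q<i i≤Q))
    kept _          (same _)     = refl
    byCase : Dec (Shifted c) → (k : ℕ) → toℕ i ≡ k → Σ (Fin n) (λ ρ → Allowed c ρ × label c ρ ≡ i)
    byCase (no ¬s) _       _  = i , (λ (s , _) → ¬s s) , kept (inj₁ ¬s) (label-view c i)
    byCase (yes s) zero    eᵢ = ⊥-elim (zeroPart⇒¬InRange a c i (firstZero i eᵢ) p)
    byCase (yes s) (suc m) eᵢ with m ≤? Q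
    ... | no m≰Q  = i , (λ (_ , e) → m≰Q (≤-reflexive (suc-injective (trans (sym eᵢ) e)))) ,
                    kept (inj₂ (subst (Q <_) (sym eᵢ) (m<n⇒m<1+n (≰⇒> m≰Q)))) (label-view c i)
    ... | yes m≤Q = ρ , (λ (_ , e) → <-irrefl (trans (sym eρ) e) (s≤s m≤Q)) , toℕ-injective (lifted (label-view c ρ))
      where
      m<n : m < n
      m<n = ≤-trans (s≤s m≤Q) (<⇒≤ Q+1<n)
      ρ = fromℕ< m<n
      eρ : toℕ ρ ≡ m
      eρ = toℕ-fromℕ< m<n
      lifted : ∀ {x} → LabelView c ρ x → toℕ x ≡ toℕ i
      lifted (up _ _ e) = trans e (trans (cong suc eρ) (sym eᵢ))
      lifted (same ¬up) = ⊥-elim (¬up (s , subst (_≤ Q) (sym eρ) m≤Q))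

  label-descends : ∀ c c′ r r′ → toℕ c < toℕ c′ → Allowed c′ r′ → label c′ r′ ≡ label c r →
    toℕ r′ ≤ toℕ r
  label-descends c c′ r r′ c<c′ allowed′ e = descends (label-view c r) (label-view c′ r′) (cong toℕ e)
    where
    descends : ∀ {x x′} → LabelView c r x → LabelView c′ r′ x′ → toℕ x′ ≡ toℕ x → toℕ r′ ≤ toℕ r
    descends v         (up _ _ e′)  eq = ≤-pred (subst (_≤ suc (toℕ r)) (trans (sym eq) e′) (view-≤ v))
    descends (same _)  (same _)     eq = ≤-reflexive eq
    descends (up s r≤Q e) (same ¬up′) eq =
      ⊥-elim (allowed′ (s′ , ≤-antisym (subst (_≤ suc Q) (trans (sym e) (sym eq)) (s≤s r≤Q))
                                      (≰⇒> (λ r′≤Q → ¬up′ (s′ , r′≤Q)))))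
      where
      s′ = shifted-mono c c′ s c<c′

  shifted-IsLKT : IsLKT a shifted
  shifted-IsLKT = d1 , d2 , d3 , d4
    where
    d1 : Cond1 a shifted
    d1 = Cond1-intro a shifted (λ c r i e → proj₂ (proj₂ (shifted-just c r i e)))
      (λ c i p → let (ρ , allowed , e) = label-preimage c i p in
                 ρ , trans (shifted-filled c ρ allowed (subst (InRange a c) (sym e) p)) (cong just e))
      (λ c r r′ i e e′ → let (al , l , _) = shifted-just c r i e ; (al′ , l′ , _) = shifted-just c r′ i e′ in
                         label-injective c r r′ al al′ (trans l (sym l′)))
    d2 : Cond2 shifted
    d2 c r i e with shifted-just c r i e
    ... | _ , refl , _ = view-≥ (label-view c r)
    d3 : Cond3 shifted
    d3 i c c′ r r′ c<c′ e e′ with shifted-just c r i e | shifted-just c′ r′ i e′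
    ... | _ , refl , _ | allowed′ , l′ , _ = label-descends c c′ r r′ c<c′ allowed′ l′
    d4 : Cond4 shifted
    d4 c r r′ i j r<r′ e e′ with shifted-just c r i e | shifted-just c r′ j e′
    ... | _ , refl , _ | allowed′ , refl , _ = label-< c r r′ allowed′ r<r′

  rowEmpty : RowEmpty shifted (suc Q)
  rowEmpty c r r≡Q+1 with shifted c r in eq
  ... | nothing = refl
  ... | just i with shifted-just c r i eq
  ...   | allowed , l , p = ⊥-elim (unshifted (label-view c r) l)
    where
    ¬s : ¬ Shifted c
    ¬s s = allowed (s , r≡Q+1)
    unshifted : ∀ {x} → LabelView c r x → x ≡ i → ⊥
    unshifted (up s _ _) _    = ¬s s
    unshifted (same _)   refl = ¬s (subst (InRange a c) (toℕ-injective (trans r≡Q+1 (sym q+1≡))) p)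

  separating : Separating a
  separating = record
    { q = Q ; q+1<n = Q+1<n ; T = shifted ; isLKT = shifted-IsLKT ; empty = rowEmpty
    ; c₀ = c₀ ; r₀ = q ; r₀≡q = refl
    ; ownLabel = trans (shifted-filled c₀ q (λ (s , _) → ¬s₀ s) (subst (InRange a c₀) (sym labelq) inRange₀))
                       (cong just labelq) }
    where
    aq≤M = lookup≤maxPart a q
    c₀ = proj₁ (firstColumn a q (<-≤-trans (s≤s z≤n) descent))
    c₀≡ : toℕ c₀ ≡ maxPart a ∸ lookup a q
    c₀≡ = proj₂ (firstColumn a q (<-≤-trans (s≤s z≤n) descent))
    inRange₀ : InRange a c₀ q
    inRange₀ = ≤-reflexive (sym c₀≡)
    ¬s₀ : ¬ Shifted c₀
    ¬s₀ s = <-irrefl refl (≤-trans (∸-monoʳ-< descent aq≤M) (subst (maxPart a ∸ lookup a q+1 ≤_) c₀≡ s))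
    unshifted : ∀ {x} → LabelView c₀ q x → x ≡ q
    unshifted (up s _ _) = ⊥-elim (¬s₀ s)
    unshifted (same _)   = refl
    labelq : label c₀ q ≡ q
    labelq = unshifted (label-view c₀ q)

-- The m-th part of a, indexed by ℕ (0 beyond the length).
part : ∀ {n} → Vec ℕ n → ℕ → ℕ
part []      _       = 0
part (x ∷ a) zero    = x
part (x ∷ a) (suc m) = part a m

part-lookup : ∀ {n} (a : Vec ℕ n) i → lookup a i ≡ part a (toℕ i)
part-lookup (x ∷ a) fz     = refl
part-lookup (x ∷ a) (fs i) = part-lookup a i

part-fromℕ< : ∀ {n} (a : Vec ℕ n) {m} (m<n : m < n) → lookup a (fromℕ< m<n) ≡ part a m
part-fromℕ< a m<n = trans (part-lookup a (fromℕ< m<n)) (cong (part a) (toℕ-fromℕ< m<n))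

adjacent⇒WeaklyIncreasing : ∀ {n} (a : Vec ℕ n) → (∀ m → suc m < n → part a m ≤ part a (suc m)) →
  WeaklyIncreasing a
adjacent⇒WeaklyIncreasing {n} a adj i j i≤j =
  subst₂ _≤_ (sym (part-lookup a i)) (trans (cong (part a) (m+[n∸m]≡n i≤j)) (sym (part-lookup a j)))
    (steps (toℕ j ∸ toℕ i) (toℕ i) (subst (_< n) (sym (m+[n∸m]≡n i≤j)) (toℕ<n j)))
  where
  steps : ∀ d m → m + d < n → part a m ≤ part a (m + d)
  steps zero    m l rewrite +-identityʳ m = ≤-refl
  steps (suc d) m l rewrite +-suc m d =
    ≤-trans (steps d m (<-trans (n<1+n _) l)) (adj (m + d) l)

-- A content with a zero part and a descent a_{q+1} < a_q admits a separating tableau: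
-- if some positive part is followed by a zero part, the key diagram separates; otherwise
-- a_0 = 0 (else all parts would be positive) and the shifted diagram separates.
zeroAndDescent⇒separating : ∀ {n} (a : Vec ℕ n) →
  ∃ (λ p → p < n × part a p ≡ 0) → ∃ (λ q → suc q < n × part a (suc q) < part a q) → Separating a
zeroAndDescent⇒separating {n} a (p , p<n , zeroAt-p) (q , q+1<n , descent)
  with anyUpTo? (λ m → (suc m <? n) ×-dec ((0 <? part a m) ×-dec (part a (suc m) ≟ 0))) n
... | yes (m , _ , m+1<n , pos , zeroAfter) =
  KeyDiagram.positiveThenZero⇒separating a (fromℕ< (<-trans (n<1+n m) m+1<n)) (fromℕ< m+1<n)
    (trans (toℕ-fromℕ< m+1<n) (cong suc (sym (toℕ-fromℕ< (<-trans (n<1+n m) m+1<n)))))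
    (subst (0 <_) (sym (part-fromℕ< a (<-trans (n<1+n m) m+1<n))) pos) (trans (part-fromℕ< a m+1<n) zeroAfter)
... | no noPositiveThenZero =
  ShiftedDiagram.separating a (fromℕ< (<-trans (n<1+n q) q+1<n)) (fromℕ< q+1<n)
    (trans (toℕ-fromℕ< q+1<n) (cong suc (sym (toℕ-fromℕ< (<-trans (n<1+n q) q+1<n)))))
    (subst₂ _<_ (sym (part-fromℕ< a q+1<n)) (sym (part-fromℕ< a (<-trans (n<1+n q) q+1<n))) descent)
    (λ i i≡0 → trans (part-lookup a i) (trans (cong (part a) i≡0) firstZero))
  where
  positiveUpTo : 0 < part a 0 → ∀ m → m < n → 0 < part a m
  positiveUpTo pos₀ zero    _   = pos₀
  positiveUpTo pos₀ (suc m) m<n with part a (suc m) ≟ 0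
  ... | no  ≢0 = n≢0⇒n>0 ≢0
  ... | yes ≡0 = ⊥-elim (noPositiveThenZero (m , <-trans (n<1+n m) m<n , m<n ,
                   positiveUpTo pos₀ m (<-trans (n<1+n m) m<n) , ≡0))
  firstZero : part a 0 ≡ 0
  firstZero = n≤0⇒n≡0 (≮⇒≥ (λ pos₀ → <-irrefl (sym zeroAt-p) (positiveUpTo pos₀ p p<n)))

trichotomy : ∀ {n} (a : Vec ℕ n) → NoZeroParts a ⊎ WeaklyIncreasing a ⊎ Separating a
trichotomy {n} a with anyUpTo? (λ m → (suc m <? n) ×-dec (part a (suc m) <? part a m)) n
... | no noDescent = inj₂ (inj₁ (adjacent⇒WeaklyIncreasing a
        (λ m m+1<n → ≮⇒≥ (λ desc → noDescent (m , <-trans (n<1+n m) m+1<n , m+1<n , desc)))))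
... | yes (q , _ , descent) with anyUpTo? (λ m → part a m ≟ 0) n
...   | no noZero = inj₁ (λ i → subst (0 <_) (sym (part-lookup a i))
                      (n≢0⇒n>0 (λ z → noZero (toℕ i , toℕ<n i , z))))
...   | yes (p , p<n , z) = inj₂ (inj₂ (zeroAndDescent⇒separating a (p , p<n , z) (q , descent)))

proposition3p4 : (n : ℕ) (a : Vec ℕ n) →
    QuasiSymmetric n (lockCoeff a) ⇔ (NoZeroParts a ⊎ WeaklyIncreasing a)
proposition3p4 n a = mk⇔ onlyIf if′
  where
  onlyIf : QuasiSymmetric n (lockCoeff a) → NoZeroParts a ⊎ WeaklyIncreasing a
  onlyIf qs with trichotomy a
  ... | inj₁ nz         = inj₁ nz
  ... | inj₂ (inj₁ wi)  = inj₂ wi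
  ... | inj₂ (inj₂ sep) = ⊥-elim (separating⇒¬QuasiSymmetric a sep qs)
  lockCoeff-invariant : LiftingProperty a → ZeroShiftInvariant n (lockCoeff a)
  lockCoeff-invariant lifting = (λ _ _ → lockCoeff-cong a) , lockCoeff-swap a lifting
  if′ : NoZeroParts a ⊎ WeaklyIncreasing a → QuasiSymmetric n (lockCoeff a)
  if′ cond = ZeroShiftInvariant⇒QuasiSymmetric n (lockCoeff a) (lockCoeff-invariant (lifting cond))
    where
    lifting : NoZeroParts a ⊎ WeaklyIncreasing a → LiftingProperty a
    lifting (inj₁ nz) = noZeroParts⇒lifting a nz
    lifting (inj₂ wi) = weaklyIncreasing⇒lifting a wi
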